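{- Let $\phi=C_1\wedge\dots\wedge C_m$ and the strings $S_0,\dots,S_m$ be as below. Let $X$ be a subsequence of $S_0$ that contains exactly one of $x_j$ or $\bar x_j$ for each $1\le j\le v$. Let $1\le i\le m$ and $C_i=\ell^{(i)}_1\vee\ell^{(i)}_2\vee\ell^{(i)}_3$. Then $X$ is a subsequence of $S_i$ if and only if $X$ does not contain $\bar\ell^{(i)}_1\bar\ell^{(i)}_2\bar\ell^{(i)}_3$ as a subsequence.
   Context: $\phi$ is a 3-CNF formula on variables $x_1,\dots,x_v$; each clause is $C_i=\ell^{(i)}_1\vee\ell^{(i)}_2\vee\ell^{(i)}_3$ with $\ell^{(i)}_1\in\{x_\alpha,\bar x_\alpha\}$, $\ell^{(i)}_2\in\{x_\beta,\bar x_\beta\}$, $\ell^{(i)}_3\in\{x_\gamma,\bar x_\gamma\}$ for some $1\le\alpha<\beta<\gamma\le v$; no clause contains both $x_j$ and $\bar x_j$, and no variable appears in every clause. For a literal $\ell$, $\bar\ell$ denotes its negation ($\bar{\bar x}_j=x_j$). The alphabet is $\{x_1,\bar x_1,\dots,x_v,\bar x_v\}$. Let $R=x_v\bar x_v\cdots x_1\bar x_1$ and $X^t$ denote $X$ repeated $t$ times. $S_0=x_1\bar x_1\cdots x_v\bar x_v$ and $S_i=R^{\alpha-1}\ell^{(i)}_1R^{\beta-\alpha}\ell^{(i)}_2R^{\gamma-\beta}\ell^{(i)}_3R^{v-\gamma}$ for $1\le i\le m$. A string $Y$ is a subsequence of $X$ if it is obtained from $X$ by deleting characters. -}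

module Defs where

open import Data.Nat using (ℕ; suc; _∸_)
open import Data.Bool using (Bool; true; false; not)
open import Data.Fin using (Fin; toℕ; _<_)
open import Data.List using (List; []; _∷_; _++_; concat; concatMap; replicate; reverse; allFin)
open import Data.List.Membership.Propositional using (_∈_)
open import Data.List.Relation.Binary.Sublist.Propositional using (_⊆_)
open import Data.Product using (_×_; ∃)
open import Data.Sum using (_⊎_)
open import Relation.Nullary using (¬_)
open import Relation.Binary.PropositionalEquality using (_≡_)

-- Variables x_1,…,x_v are indexed by Fin v (index j : Fin v stands for x_{j+1}).
-- A literal is a variable together with a sign: true = x_j, false = x̄_j.
record Literal (v : ℕ) : Set where
  constructor lit
  field
    var  : Fin v
    sign : Bool
open Literal public

pos neg : ∀ {v} → Fin v → Literal v
pos j = lit j true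
neg j = lit j false

‾_ : ∀ {v} → Literal v → Literal v
‾ (lit j s) = lit j (not s)

-- A 3-clause ℓ₁ ∨ ℓ₂ ∨ ℓ₃ on variables α < β < γ.
-- (Strict ordering implies no clause contains both x_j and x̄_j.)
record Clause (v : ℕ) : Set where
  field
    ℓ₁ ℓ₂ ℓ₃ : Literal v
    α<β : var ℓ₁ < var ℓ₂
    β<γ : var ℓ₂ < var ℓ₃
open Clause public

OccursIn : ∀ {v} → Fin v → Clause v → Set
OccursIn j C = (var (ℓ₁ C) ≡ j) ⊎ (var (ℓ₂ C) ≡ j) ⊎ (var (ℓ₃ C) ≡ j)

NoVarInAllClauses : ∀ {v m} → (Fin m → Clause v) → Set
NoVarInAllClauses {v} {m} φ = (j : Fin v) → ∃ λ (i : Fin m) → ¬ OccursIn j (φ i)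

Str : ℕ → Set
Str v = List (Literal v)

rep : ∀ {A : Set} → ℕ → List A → List A
rep t X = concat (replicate t X)

S₀ : (v : ℕ) → Str v
S₀ v = concatMap (λ j → pos j ∷ neg j ∷ []) (allFin v)

R : (v : ℕ) → Str v
R v = concatMap (λ j → pos j ∷ neg j ∷ []) (reverse (allFin v))

-- S_i = R^{α-1} ℓ₁ R^{β-α} ℓ₂ R^{γ-β} ℓ₃ R^{v-γ}
-- with 0-based indices a = α-1, b = β-1, c = γ-1.
S : ∀ {v} → Clause v → Str v
S {v} C =
  rep (toℕ a) (R v) ++ ℓ₁ C ∷ rep (toℕ b ∸ toℕ a) (R v) ++ ℓ₂ C ∷
  rep (toℕ c ∸ toℕ b) (R v) ++ ℓ₃ C ∷ rep (v ∸ suc (toℕ c)) (R v)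
  where
    a = var (ℓ₁ C)
    b = var (ℓ₂ C)
    c = var (ℓ₃ C)

ExactlyOneLiteral : ∀ {v} → Str v → Set
ExactlyOneLiteral {v} X = (j : Fin v) →
  (pos j ∈ X × ¬ neg j ∈ X) ⊎ (neg j ∈ X × ¬ pos j ∈ X)

-- A subsequence X of S₀ with exactly one literal per variable is the string of the literals made
-- true by some assignment, listed in increasing variable order.  Every copy of R is
-- non-increasing in the variable, so it can host at most one letter of X, and X, having v
-- letters, needs v copies of R.  S_i consists of only v − 1 copies of R together with the three
-- literals of C_i, so X ⊆ S_i forces X to use one of those literals, i.e. the assignment
-- satisfies C_i; it cannot if X contains all three negations.  Conversely, if X contains a
-- literal ℓ of C_i at variable j, the j letters of X before ℓ fit into the j copies of R
-- preceding ℓ in S_i, and the v − 1 − j letters after ℓ into the copies following it.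
module Submission where

open import Defs
open import Data.Nat using (ℕ)
open import Data.Fin using (Fin)
open import Data.List using (List; []; _∷_)
open import Data.List.Relation.Binary.Sublist.Propositional using (_⊆_)
open import Function.Bundles using (_⇔_)
open import Relation.Nullary using (¬_)

open import Data.Bool using (Bool; true; false)
open import Data.Bool.Properties using (¬-not; not-¬) renaming (_≟_ to _≟ᵇ_)
open import Data.Empty using (⊥; ⊥-elim)
open import Data.Fin using (zero; suc; toℕ)
import Data.Fin as Fin
open import Data.Fin.Properties using (toℕ<n) renaming (<-irrefl to <ᶠ-irrefl; <-asym to <ᶠ-asym)
open import Data.List using (_++_; length; map; reverse; tabulate; concatMap; allFin)
open import Data.List.Membership.Propositional using (_∈_; _∉_)
open import Data.List.Membership.Propositional.Properties
  using (∈-allFin; ∈-concat⁺′; ∈-map⁺; ∈-tabulate⁻)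
open import Data.List.Properties using (++-assoc; length-tabulate; map-tabulate; unfold-reverse)
open import Data.List.Relation.Binary.Sublist.Propositional
  using ([]; _∷_; _∷ʳ_; ⊆-refl; ⊆-trans; lookup; minimum; from∈)
open import Data.List.Relation.Binary.Sublist.Propositional.Properties using (++⁺; ∷ˡ⁻)
open import Data.List.Relation.Unary.All as All using (All; []; _∷_)
import Data.List.Relation.Unary.All.Properties as All
open import Data.List.Relation.Unary.AllPairs as AllPairs using (AllPairs; []; _∷_)
import Data.List.Relation.Unary.AllPairs.Properties as AllPairs
open import Data.List.Relation.Unary.Any as Any using (here; there)
import Data.List.Relation.Unary.Any.Properties as Any
open import Data.List.Relation.Unary.Unique.Propositional using (Unique)
import Data.List.Relation.Unary.Unique.Propositional.Properties as Unique
open import Data.Nat using (zero; suc; _+_; _∸_; _≤_; _<_; s≤s; z≤n)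
open import Data.Nat.Properties
  using (m+[n∸m]≡n; +-∸-comm; <⇒≤; <-trans; <-irrefl; ≤-trans; ≤-reflexive)
open import Data.Product using (_,_)
open import Data.Sum using (inj₁; inj₂; [_,_]′)
open import Function using (_∘_; id; flip; const)
open import Function.Bundles using (mk⇔)
open import Relation.Binary.PropositionalEquality using (_≡_; refl; sym; trans; cong; subst; subst₂)
open import Relation.Nullary using (yes; no)

module _ {A : Set} where

  ⊆-drop : ∀ {z : A} {ys} as {bs} → z ∉ ys → ys ⊆ as ++ z ∷ bs → ys ⊆ as ++ bs
  ⊆-drop []       z∉ (_ ∷ʳ p)   = p
  ⊆-drop []       z∉ (refl ∷ p) = ⊥-elim (z∉ (here refl))
  ⊆-drop (a ∷ as) z∉ (_ ∷ʳ p)   = a ∷ʳ ⊆-drop as z∉ p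
  ⊆-drop (a ∷ as) z∉ (refl ∷ p) = refl ∷ ⊆-drop as (z∉ ∘ there) p

  ⊆-complete⇒≡ : ∀ {xs ys : List A} → Unique ys → xs ⊆ ys → All (_∈ xs) ys → xs ≡ ys
  ⊆-complete⇒≡ []           []         []          = refl
  ⊆-complete⇒≡ (y≢ys ∷ _)   (y ∷ʳ p)   (y∈xs ∷ _)  = ⊥-elim (All.lookup y≢ys (lookup p y∈xs) refl)
  ⊆-complete⇒≡ (y≢ys ∷ ys!) (refl ∷ p) (_ ∷ ys∈xs) =
    cong (_ ∷_) (⊆-complete⇒≡ ys! p
      (All.zipWith (λ (y≢x , x∈) → Any.tail (y≢x ∘ sym) x∈) (y≢ys , ys∈xs)))

  All-reverse⁺ : ∀ {P : A → Set} {xs} → All P xs → All P (reverse xs)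
  All-reverse⁺ ps = All.tabulate (All.lookup ps ∘ Any.reverse⁻)

  AllPairs-reverse⁺ : ∀ {Q : A → A → Set} {xs} → AllPairs Q xs → AllPairs (flip Q) (reverse xs)
  AllPairs-reverse⁺ [] = []
  AllPairs-reverse⁺ {xs = x ∷ xs} (x~xs ∷ pxs) rewrite unfold-reverse x xs =
    AllPairs.++⁺ (AllPairs-reverse⁺ pxs) ([] ∷ []) (All-reverse⁺ (All.map (_∷ []) x~xs))

∸-gap : ∀ {p q n} → p ≤ q → q < n → (q ∸ p) + (n ∸ suc q) ≡ n ∸ suc p
∸-gap {p} {q} {n} p≤q q<n =
  trans (sym (+-∸-comm (n ∸ suc q) (s≤s p≤q))) (cong (_∸ suc p) (m+[n∸m]≡n q<n))

module _ {A : Set} (xs : List A) where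

  rep-+ : ∀ m n → rep (m + n) xs ≡ rep m xs ++ rep n xs
  rep-+ zero    n = refl
  rep-+ (suc m) n = trans (cong (xs ++_) (rep-+ m n)) (sym (++-assoc xs (rep m xs) (rep n xs)))

  rep-∸ : ∀ {m n} → m ≤ n → rep m xs ++ rep (n ∸ m) xs ≡ rep n xs
  rep-∸ {m} {n} m≤n = trans (sym (rep-+ m (n ∸ m))) (cong (λ k → rep k xs) (m+[n∸m]≡n m≤n))

  rep-+-insert : ∀ m n {z} → rep (m + n) xs ⊆ rep m xs ++ z ∷ rep n xs
  rep-+-insert m n {z} =
    subst (_⊆ rep m xs ++ z ∷ rep n xs) (sym (rep-+ m n)) (++⁺ ⊆-refl (z ∷ʳ ⊆-refl))

  rep-∸-insert : ∀ {m n z ws} → m ≤ n → rep n xs ++ ws ⊆ rep m xs ++ z ∷ rep (n ∸ m) xs ++ ws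
  rep-∸-insert {m} {n} {z} {ws} m≤n =
    subst₂ _⊆_ (cong (λ k → rep k xs ++ ws) (m+[n∸m]≡n m≤n))
               (++-assoc (rep m xs) (z ∷ rep (n ∸ m) xs) ws)
               (++⁺ (rep-+-insert m (n ∸ m)) ⊆-refl)

  ⊆-rep-∸-drop : ∀ {m n z ws ys} → z ∉ ys → m ≤ n →
                 ys ⊆ rep m xs ++ z ∷ rep (n ∸ m) xs ++ ws → ys ⊆ rep n xs ++ ws
  ⊆-rep-∸-drop {m} {n} {ws = ws} z∉ m≤n p =
    subst (_ ⊆_) (trans (sym (++-assoc (rep m xs) _ ws)) (cong (_++ ws) (rep-∸ m≤n)))
          (⊆-drop (rep m xs) z∉ p)

  ⊆-rep-length : ∀ {ys} → All (_∈ xs) ys → ys ⊆ rep (length ys) xs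
  ⊆-rep-length []          = minimum _
  ⊆-rep-length (y∈ ∷ ys∈) = ++⁺ (from∈ y∈) (⊆-rep-length ys∈)

  rep-∸-suc-insert : ∀ {p q n z} → p ≤ q → q < n →
                     rep (n ∸ suc p) xs ⊆ rep (q ∸ p) xs ++ z ∷ rep (n ∸ suc q) xs
  rep-∸-suc-insert {p} {q} {n} {z} p≤q q<n =
    subst (λ k → rep k xs ⊆ rep (q ∸ p) xs ++ z ∷ rep (n ∸ suc q) xs) (∸-gap p≤q q<n)
      (rep-+-insert (q ∸ p) (n ∸ suc q))

  tabulate-⊆-rep : ∀ {n} {g : Fin n → A} → (∀ i → g i ∈ xs) → (j : Fin n) →
                   tabulate g ⊆ rep (toℕ j) xs ++ g j ∷ rep (n ∸ suc (toℕ j)) xs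
  tabulate-⊆-rep {suc n} {g} g∈ zero =
    refl ∷ subst (λ k → tabulate (g ∘ suc) ⊆ rep k xs) (length-tabulate (g ∘ suc))
                 (⊆-rep-length (All.tabulate⁺ (g∈ ∘ suc)))
  tabulate-⊆-rep {suc n} g∈ (suc j) =
    subst (_ ⊆_) (sym (++-assoc xs _ _)) (++⁺ (from∈ (g∈ zero)) (tabulate-⊆-rep (g∈ ∘ suc) j))

module _ {A : Set} where

  tabulate-⊇₁ : ∀ {n} {g : Fin n → A} {x} (i : Fin n) → x ≡ g i → x ∷ [] ⊆ tabulate g
  tabulate-⊇₁ zero    x≡ = x≡ ∷ minimum _
  tabulate-⊇₁ {g = g} (suc i) x≡ = _ ∷ʳ tabulate-⊇₁ {g = g ∘ suc} i x≡

  tabulate-⊇₂ : ∀ {n} {g : Fin n → A} {x y} (i j : Fin n) → i Fin.< j →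
                x ≡ g i → y ≡ g j → x ∷ y ∷ [] ⊆ tabulate g
  tabulate-⊇₂ {g = g} zero    (suc j) _         x≡ y≡ = x≡ ∷ tabulate-⊇₁ {g = g ∘ suc} j y≡
  tabulate-⊇₂ {g = g} (suc i) (suc j) (s≤s i<j) x≡ y≡ = _ ∷ʳ tabulate-⊇₂ {g = g ∘ suc} i j i<j x≡ y≡

  tabulate-⊇₃ : ∀ {n} {g : Fin n → A} {x y z} (i j k : Fin n) → i Fin.< j → j Fin.< k →
                x ≡ g i → y ≡ g j → z ≡ g k → x ∷ y ∷ z ∷ [] ⊆ tabulate g
  tabulate-⊇₃ {g = g} zero    (suc j) (suc k) _         (s≤s j<k) x≡ y≡ z≡ =
    x≡ ∷ tabulate-⊇₂ {g = g ∘ suc} j k j<k y≡ z≡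
  tabulate-⊇₃ {g = g} (suc i) (suc j) (suc k) (s≤s i<j) (s≤s j<k) x≡ y≡ z≡ =
    _ ∷ʳ tabulate-⊇₃ {g = g ∘ suc} i j k i<j j<k x≡ y≡ z≡

module _ {A : Set} {_≺_ : A → A → Set} where

  ⊆-++-skip : ∀ {y : A} {as ys ws} → All (λ a → ¬ y ≺ a) as → All (y ≺_) ys →
              ys ⊆ as ++ ws → ys ⊆ ws
  ⊆-++-skip []          _           p          = p
  ⊆-++-skip (_ ∷ y≮as)  y<ys        (_ ∷ʳ p)   = ⊆-++-skip y≮as y<ys p
  ⊆-++-skip (y≮a ∷ _)   (y<a ∷ _)   (refl ∷ p) = ⊥-elim (y≮a y<a)

  ascending-∷-⊆-++ : ∀ {y : A} {as ys ws} → AllPairs (λ a b → ¬ a ≺ b) as →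
                     AllPairs _≺_ (y ∷ ys) → y ∷ ys ⊆ as ++ ws → ys ⊆ ws
  ascending-∷-⊆-++ {as = []}    _          _          p          = ∷ˡ⁻ p
  ascending-∷-⊆-++ {as = _ ∷ _} (_ ∷ as≮)  y∷ys↑      (_ ∷ʳ p)   = ascending-∷-⊆-++ as≮ y∷ys↑ p
  ascending-∷-⊆-++ {as = _ ∷ _} (a≮as ∷ _) (y<ys ∷ _) (refl ∷ p) = ⊆-++-skip a≮as y<ys p

  ascending-⊆-rep⇒length≤ : ∀ {xs ys : List A} t → AllPairs (λ a b → ¬ a ≺ b) xs →
                            AllPairs _≺_ ys → ys ⊆ rep t xs → length ys ≤ t
  ascending-⊆-rep⇒length≤ zero    _   []           [] = z≤n
  ascending-⊆-rep⇒length≤ (suc t) _   []           _  = z≤n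
  ascending-⊆-rep⇒length≤ (suc t) xs≮ (y<ys ∷ ys↑) p  =
    s≤s (ascending-⊆-rep⇒length≤ t xs≮ ys↑ (ascending-∷-⊆-++ xs≮ (y<ys ∷ ys↑) p))

module _ {v : ℕ} where

  _<ᵛ_ : Literal v → Literal v → Set
  x <ᵛ y = var x Fin.< var y

  bothLiterals : Fin v → Str v
  bothLiterals j = pos j ∷ neg j ∷ []

  ∈-R : (x : Literal v) → x ∈ R v
  ∈-R (lit j b) = ∈-concat⁺′ (∈-bothLiterals b) (∈-map⁺ bothLiterals (Any.reverse⁺ (∈-allFin j)))
    where
      ∈-bothLiterals : ∀ b → lit j b ∈ bothLiterals j
      ∈-bothLiterals true  = here refl
      ∈-bothLiterals false = there (here refl)

  R-nonascending : AllPairs (λ x y → ¬ x <ᵛ y) (R v)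
  R-nonascending =
    AllPairs.concat⁺ (All.map⁺ (All.universal (λ _ → (<ᶠ-irrefl refl ∷ []) ∷ [] ∷ []) _))
      (AllPairs.map⁺ (AllPairs.map later-block (AllPairs-reverse⁺ (AllPairs.tabulate⁺-< id))))
    where
      later-block : ∀ {i j} → j Fin.< i →
                    All (λ x → All (λ y → ¬ x <ᵛ y) (bothLiterals j)) (bothLiterals i)
      later-block j<i = let i≮j = <ᶠ-asym j<i in (i≮j ∷ i≮j ∷ []) ∷ (i≮j ∷ i≮j ∷ []) ∷ []

  trueLiterals : (Fin v → Bool) → Str v
  trueLiterals s = tabulate (λ j → lit j (s j))

  padded : Literal v → Str v
  padded x = rep (toℕ (var x)) (R v) ++ x ∷ rep (v ∸ suc (toℕ (var x))) (R v)

  module _ (s : Fin v → Bool) where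

    trueLiterals-ascending : AllPairs _<ᵛ_ (trueLiterals s)
    trueLiterals-ascending = AllPairs.tabulate⁺-< id

    ∈-trueLiterals⁻ : ∀ {x} → x ∈ trueLiterals s → sign x ≡ s (var x)
    ∈-trueLiterals⁻ x∈ with ∈-tabulate⁻ x∈
    ... | _ , refl = refl

    trueLiterals-consistent : ∀ {x} → x ∈ trueLiterals s → ‾ x ∈ trueLiterals s → ⊥
    trueLiterals-consistent x∈ ‾x∈ =
      not-¬ refl (trans (∈-trueLiterals⁻ x∈) (sym (∈-trueLiterals⁻ ‾x∈)))

    trueLiterals-⊆-padded : ∀ {x} → s (var x) ≡ sign x → trueLiterals s ⊆ padded x
    trueLiterals-⊆-padded {x} s≡ =
      subst (λ b → trueLiterals s ⊆ padded (lit (var x) b)) s≡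
            (tabulate-⊆-rep (R v) (∈-R ∘ _) (var x))

    ⊆-bothLiterals⇒⊆-map : ∀ {Y} js → All (λ x → sign x ≡ s (var x)) Y →
                           Y ⊆ concatMap bothLiterals js → Y ⊆ map (λ j → lit j (s j)) js
    ⊆-bothLiterals⇒⊆-map []       []            []                = []
    ⊆-bothLiterals⇒⊆-map (_ ∷ _)  (t≡ ∷ f≡ ∷ _) (refl ∷ refl ∷ _) =
      ⊥-elim (not-¬ refl (trans t≡ (sym f≡)))
    ⊆-bothLiterals⇒⊆-map (j ∷ js) (t≡ ∷ ≡s) (refl ∷ _ ∷ʳ p) =
      cong (lit j) t≡ ∷ ⊆-bothLiterals⇒⊆-map js ≡s p
    ⊆-bothLiterals⇒⊆-map (j ∷ js) (f≡ ∷ ≡s) (_ ∷ʳ refl ∷ p) =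
      cong (lit j) f≡ ∷ ⊆-bothLiterals⇒⊆-map js ≡s p
    ⊆-bothLiterals⇒⊆-map (_ ∷ js) ≡s (_ ∷ʳ _ ∷ʳ p) =
      _ ∷ʳ ⊆-bothLiterals⇒⊆-map js ≡s p

    ⊆S₀⇒≡trueLiterals : ∀ {X} → All (λ x → sign x ≡ s (var x)) X → (∀ j → lit j (s j) ∈ X) →
                        X ⊆ S₀ v → X ≡ trueLiterals s
    ⊆S₀⇒≡trueLiterals ≡s s∈ X⊆S₀ =
      ⊆-complete⇒≡ (Unique.tabulate⁺ (cong var))
                   (subst (_ ⊆_) (map-tabulate id _) (⊆-bothLiterals⇒⊆-map (allFin v) ≡s X⊆S₀))
                   (All.tabulate⁺ s∈)

module _ {v : ℕ} {X : Str v} (E : ExactlyOneLiteral X) where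

  chosenSign : Fin v → Bool
  chosenSign j = [ const true , const false ]′ (E j)

  chosenLiteral∈ : ∀ j → lit j (chosenSign j) ∈ X
  chosenLiteral∈ j with E j
  ... | inj₁ (pos∈ , _) = pos∈
  ... | inj₂ (neg∈ , _) = neg∈

  ∈⇒sign≡chosenSign : ∀ {x} → x ∈ X → sign x ≡ chosenSign (var x)
  ∈⇒sign≡chosenSign {lit j true} x∈ with E j
  ... | inj₁ _          = refl
  ... | inj₂ (_ , pos∉) = ⊥-elim (pos∉ x∈)
  ∈⇒sign≡chosenSign {lit j false} x∈ with E j
  ... | inj₁ (_ , neg∉) = ⊥-elim (neg∉ x∈)
  ... | inj₂ _          = refl

  ExactlyOneLiteral⇒≡trueLiterals : X ⊆ S₀ v → X ≡ trueLiterals chosenSign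
  ExactlyOneLiteral⇒≡trueLiterals =
    ⊆S₀⇒≡trueLiterals chosenSign (All.tabulate ∈⇒sign≡chosenSign) chosenLiteral∈

module _ {v : ℕ} (C : Clause v) where

  private
    p₁ p₂ p₃ : ℕ
    p₁ = toℕ (var (ℓ₁ C))
    p₂ = toℕ (var (ℓ₂ C))
    p₃ = toℕ (var (ℓ₃ C))

    p₁≤p₂ : p₁ ≤ p₂
    p₁≤p₂ = <⇒≤ (α<β C)

    p₂≤p₃ : p₂ ≤ p₃
    p₂≤p₃ = <⇒≤ (β<γ C)

    p₃<v : p₃ < v
    p₃<v = toℕ<n (var (ℓ₃ C))

    p₂<v : p₂ < v
    p₂<v = <-trans (β<γ C) p₃<v

  padded-ℓ₁⊆S : padded (ℓ₁ C) ⊆ S C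
  padded-ℓ₁⊆S =
    ++⁺ ⊆-refl (refl ∷ ⊆-trans (rep-∸-suc-insert (R v) p₁≤p₂ p₂<v)
                                (++⁺ ⊆-refl (refl ∷ rep-∸-suc-insert (R v) p₂≤p₃ p₃<v)))

  padded-ℓ₂⊆S : padded (ℓ₂ C) ⊆ S C
  padded-ℓ₂⊆S =
    ⊆-trans (rep-∸-insert (R v) p₁≤p₂)
            (++⁺ ⊆-refl (refl ∷ ++⁺ ⊆-refl (refl ∷ rep-∸-suc-insert (R v) p₂≤p₃ p₃<v)))

  padded-ℓ₃⊆S : padded (ℓ₃ C) ⊆ S C
  padded-ℓ₃⊆S = ⊆-trans (rep-∸-insert (R v) p₂≤p₃) (rep-∸-insert (R v) p₁≤p₂)

  -- Deleting the three literals leaves p₃ + (v ∸ suc p₃) = v − 1 copies of R.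
  avoiding-literals⇒length<v : ∀ {Y} → AllPairs _<ᵛ_ Y → ℓ₁ C ∉ Y → ℓ₂ C ∉ Y → ℓ₃ C ∉ Y →
                               Y ⊆ S C → length Y < v
  avoiding-literals⇒length<v {Y} Y↑ ℓ₁∉ ℓ₂∉ ℓ₃∉ Y⊆S =
    ≤-trans (s≤s (ascending-⊆-rep⇒length≤ (p₃ + (v ∸ suc p₃)) R-nonascending Y↑ Y⊆R^))
            (≤-reflexive (m+[n∸m]≡n p₃<v))
    where
      Y⊆R^ : Y ⊆ rep (p₃ + (v ∸ suc p₃)) (R v)
      Y⊆R^ = subst (Y ⊆_) (sym (rep-+ (R v) p₃ (v ∸ suc p₃)))
               (⊆-drop (rep p₃ (R v)) ℓ₃∉
                 (⊆-rep-∸-drop (R v) ℓ₂∉ p₂≤p₃ (⊆-rep-∸-drop (R v) ℓ₁∉ p₁≤p₂ Y⊆S)))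

  negations : Str v
  negations = ‾ ℓ₁ C ∷ ‾ ℓ₂ C ∷ ‾ ℓ₃ C ∷ []

  module _ (s : Fin v → Bool) where

    ⊆S⇒¬negations⊆ : trueLiterals s ⊆ S C → ¬ negations ⊆ trueLiterals s
    ⊆S⇒¬negations⊆ X⊆S N⊆X =
      <-irrefl (length-tabulate _)
        (avoiding-literals⇒length<v (trueLiterals-ascending s)
          (falsified (ℓ₁ C) (here refl)) (falsified (ℓ₂ C) (there (here refl)))
          (falsified (ℓ₃ C) (there (there (here refl)))) X⊆S)
      where
        falsified : ∀ x → ‾ x ∈ negations → x ∉ trueLiterals s
        falsified x ‾x∈N x∈X = trueLiterals-consistent s x∈X (lookup N⊆X ‾x∈N)

    ¬negations⊆⇒⊆S : ¬ negations ⊆ trueLiterals s → trueLiterals s ⊆ S C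
    ¬negations⊆⇒⊆S ¬N⊆X
      with s (var (ℓ₁ C)) ≟ᵇ sign (ℓ₁ C)
         | s (var (ℓ₂ C)) ≟ᵇ sign (ℓ₂ C)
         | s (var (ℓ₃ C)) ≟ᵇ sign (ℓ₃ C)
    ... | yes s₁ | _      | _      = ⊆-trans (trueLiterals-⊆-padded s s₁) padded-ℓ₁⊆S
    ... | no _   | yes s₂ | _      = ⊆-trans (trueLiterals-⊆-padded s s₂) padded-ℓ₂⊆S
    ... | no _   | no _   | yes s₃ = ⊆-trans (trueLiterals-⊆-padded s s₃) padded-ℓ₃⊆S
    ... | no ¬s₁ | no ¬s₂ | no ¬s₃ =
      ⊥-elim (¬N⊆X (tabulate-⊇₃ _ _ _ (α<β C) (β<γ C)
                      (cong (lit _) (sym (¬-not ¬s₁))) (cong (lit _) (sym (¬-not ¬s₂)))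
                      (cong (lit _) (sym (¬-not ¬s₃)))))

    trueLiterals-⊆-S⇔ : (trueLiterals s ⊆ S C) ⇔ (¬ negations ⊆ trueLiterals s)
    trueLiterals-⊆-S⇔ = mk⇔ ⊆S⇒¬negations⊆ ¬negations⊆⇒⊆S

lemma2 : (v m : ℕ) (φ : Fin m → Clause v) → NoVarInAllClauses φ →
         (X : Str v) → X ⊆ S₀ v → ExactlyOneLiteral X →
         (i : Fin m) →
         (X ⊆ S (φ i)) ⇔ (¬ ((‾ ℓ₁ (φ i)) ∷ (‾ ℓ₂ (φ i)) ∷ (‾ ℓ₃ (φ i)) ∷ []) ⊆ X)
lemma2 v m φ _ X X⊆S₀ E i =
  subst (λ Y → (Y ⊆ S (φ i)) ⇔ (¬ negations (φ i) ⊆ Y))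
        (sym (ExactlyOneLiteral⇒≡trueLiterals E X⊆S₀))
        (trueLiterals-⊆-S⇔ (φ i) (chosenSign E))
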